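{- Let $x\in D$. If $0,i,-i\in C_x$ with $i\neq 0,\frac{q^2+1}{2}$, then $2i\notin C_x$.
   Context: $q$ is an odd prime power, $\alpha$ a primitive element of $\mathbb{F}_{q^4}$, $\mathrm{Tr}(a)=a+a^q+a^{q^2}+a^{q^3}$. Let $n=(q^2+1)(q+1)$, $D=\{i\in\mathbb{Z}_n:\mathrm{Tr}(\alpha^i)=0\}$. For $x\in D$, $C_x=\{i\in\mathbb{Z}_{q^2+1}:\mathrm{Tr}(\alpha^{x+(q+1)i})=0\}$, i.e. the $i\in\{0,\dots,q^2\}$ with $x+(q+1)i\in D$; arithmetic on elements of $C_x$ is modulo $q^2+1$. -}

module Defs where

open import Level using (Level)
open import Data.Nat as ℕ using (ℕ; zero; suc; _^_; _≤_; _%_)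
open import Data.Nat.Primality using (Prime)
open import Data.Fin using (Fin)
open import Data.Product using (Σ; ∃; _×_; _,_)
open import Relation.Binary.PropositionalEquality using (_≡_)
open import Relation.Nullary using (¬_)
open import Algebra.Bundles using (CommutativeRing)

OddPrimePower : ℕ → Set
OddPrimePower q = Σ ℕ λ p → Σ ℕ λ k → Prime p × (p % 2 ≡ 1) × (1 ≤ k) × (q ≡ p ^ k)

module FieldDefs {c ℓ : Level} (R : CommutativeRing c ℓ) where
  open CommutativeRing R

  pow : Carrier → ℕ → Carrier
  pow a zero    = 1#
  pow a (suc m) = a * pow a m

  IsField : Set (c Level.⊔ ℓ)
  IsField = (¬ (1# ≈ 0#)) × (∀ a → ¬ (a ≈ 0#) → ∃ λ b → (a * b) ≈ 1#)

  HasCard : ℕ → Set (c Level.⊔ ℓ)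
  HasCard N = Σ (Fin N → Carrier) λ f →
    (∀ i j → f i ≈ f j → i ≡ j) × (∀ a → ∃ λ i → f i ≈ a)

  Primitive : Carrier → Set (c Level.⊔ ℓ)
  Primitive α = ∀ a → ¬ (a ≈ 0#) → ∃ λ j → pow α j ≈ a

  Tr : ℕ → Carrier → Carrier
  Tr q a = a + (pow a q + (pow a (q ^ 2) + pow a (q ^ 3)))

  -- j ∈ D (j taken as a natural-number representative of Z_n)
  InD : ℕ → Carrier → ℕ → Set ℓ
  InD q α j = Tr q (pow α j) ≈ 0#

  -- i ∈ C_x  (i a natural-number representative of Z_{q^2+1})
  InC : ℕ → Carrier → ℕ → ℕ → Set ℓ
  InC q α x i = InD q α (x ℕ.+ (q ℕ.+ 1) ℕ.* i)

{-# OPTIONS --safe #-}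
-- Write u = -i, β = α^(x+(q+1)u) and δ = α^((q+1)i).  That u, u+i, u+2i, u+3i lie in C_x says
-- Tr(β δ^k) = Σ_j β^(q^j) (δ^(q^j))^k = 0 for k = 0,1,2,3: a Vandermonde system in the four
-- conjugates of δ.  Since α has order q⁴-1 and q²+1 ∤ 2i, δ differs from its other conjugates, so
-- eliminating them forces β = 0, which is absurd.  Membership in C_x is periodic modulo q²+1
-- because α^((q²+1)(q+1)) lies in F_q and Tr is F_q-linear.
module Submission where

open import Defs
open import Level using (Level)
open import Algebra.Bundles using (CommutativeRing)
open import Data.Nat.Base as ℕ using (ℕ; zero; suc; NonZero; z≤n; s≤s)
import Data.Nat.Properties as ℕ
open import Data.Nat.DivMod using (m%n<n; m≡m%n+[m/n]*n)
open import Data.Nat.Divisibility using (_∣_; _∤_; m%n≡0⇒n∣m)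
open import Data.Fin.Base as Fin using (Fin; toℕ; fromℕ<; punchIn; punchOut)
open import Data.Fin.Properties
  using ( toℕ-fromℕ<; toℕ<n; nonZeroIndex; punchIn-injective; punchInᵢ≢i; punchIn-punchOut
        ; pigeonhole; injective⇒≤)
open import Data.Vec.Base as Vec using (Vec; []; _∷_)
open import Data.Vec.Relation.Unary.All using (All; []; _∷_)
import Data.Vec.Relation.Unary.All.Properties as All
open import Data.Product.Base using (∃; ∃₂; _×_; _,_; proj₁; proj₂)
open import Function.Base using (_∘_)
open import Relation.Binary.PropositionalEquality as ≡ using (_≡_; _≢_)
open import Relation.Nullary using (¬_; yes; no; contradiction)

module Powers {c ℓ : Level} (R : CommutativeRing c ℓ) where
  open CommutativeRing R
  open FieldDefs R using (pow)
  open import Algebra.Properties.CommutativeSemiring.Exp commutativeSemiring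
    using (_^_; ^-congˡ; ^-homo-*; ^-assocʳ; ^-distrib-*)
  open import Relation.Binary.Reasoning.Setoid setoid

  pow≡^ : ∀ a n → pow a n ≡ a ^ n
  pow≡^ a zero    = ≡.refl
  pow≡^ a (suc n) = ≡.cong (a *_) (pow≡^ a n)

  pow-cong : ∀ n {a b} → a ≈ b → pow a n ≈ pow b n
  pow-cong n {a} {b} rewrite pow≡^ a n | pow≡^ b n = ^-congˡ n

  pow-homo-+ : ∀ a m n → pow a (m ℕ.+ n) ≈ pow a m * pow a n
  pow-homo-+ a m n rewrite pow≡^ a (m ℕ.+ n) | pow≡^ a m | pow≡^ a n = ^-homo-* a m n

  pow-assocʳ : ∀ a m n → pow (pow a m) n ≈ pow a (m ℕ.* n)
  pow-assocʳ a m n rewrite pow≡^ (pow a m) n | pow≡^ a m | pow≡^ a (m ℕ.* n) = ^-assocʳ a m n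

  pow-distrib-* : ∀ a b n → pow (a * b) n ≈ pow a n * pow b n
  pow-distrib-* a b n rewrite pow≡^ (a * b) n | pow≡^ a n | pow≡^ b n = ^-distrib-* a b n

  pow-comm : ∀ a m n → pow (pow a m) n ≈ pow (pow a n) m
  pow-comm a m n = begin
    pow (pow a m) n   ≈⟨ pow-assocʳ a m n ⟩
    pow a (m ℕ.* n)   ≡⟨ ≡.cong (pow a) (ℕ.*-comm m n) ⟩
    pow a (n ℕ.* m)   ≈⟨ pow-assocʳ a n m ⟨
    pow (pow a n) m   ∎

  pow-1# : ∀ n → pow 1# n ≈ 1#
  pow-1# zero    = refl
  pow-1# (suc n) = trans (*-identityˡ _) (pow-1# n)

  pow-mod : ∀ a t .{{_ : NonZero t}} → pow a t ≈ 1# → ∀ j → pow a j ≈ pow a (j ℕ.% t)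
  pow-mod a t aᵗ≈1 j = begin
    pow a j                         ≡⟨ ≡.cong (pow a) (m≡m%n+[m/n]*n j t) ⟩
    pow a (r ℕ.+ s ℕ.* t)           ≈⟨ pow-homo-+ a r (s ℕ.* t) ⟩
    pow a r * pow a (s ℕ.* t)       ≡⟨ ≡.cong (λ e → pow a r * pow a e) (ℕ.*-comm s t) ⟩
    pow a r * pow a (t ℕ.* s)       ≈⟨ *-congˡ (pow-assocʳ a t s) ⟨
    pow a r * pow (pow a t) s       ≈⟨ *-congˡ (trans (pow-cong s aᵗ≈1) (pow-1# s)) ⟩
    pow a r * 1#                    ≈⟨ *-identityʳ _ ⟩
    pow a r                         ∎
    where
    r s : ℕ
    r = j ℕ.% t
    s = j ℕ./ t

module Field {c ℓ : Level} (R : CommutativeRing c ℓ) (isField : FieldDefs.IsField R) where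
  open CommutativeRing R
  open FieldDefs R using (pow)
  open Powers R
  open import Relation.Binary.Reasoning.Setoid setoid

  1≉0 : 1# ≉ 0#
  1≉0 = proj₁ isField

  *-cancelˡ : ∀ {x y z} → x ≉ 0# → x * y ≈ x * z → y ≈ z
  *-cancelˡ {x} {y} {z} x≉0 xy≈xz = begin
    y              ≈⟨ *-identityˡ y ⟨
    1# * y         ≈⟨ *-congʳ (trans (sym xx⁻¹≈1) (*-comm x x⁻¹)) ⟩
    x⁻¹ * x * y    ≈⟨ *-assoc x⁻¹ x y ⟩
    x⁻¹ * (x * y)  ≈⟨ *-congˡ xy≈xz ⟩
    x⁻¹ * (x * z)  ≈⟨ *-assoc x⁻¹ x z ⟨
    x⁻¹ * x * z    ≈⟨ *-congʳ (trans (*-comm x⁻¹ x) xx⁻¹≈1) ⟩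
    1# * z         ≈⟨ *-identityˡ z ⟩
    z              ∎
    where
    x⁻¹ : Carrier
    x⁻¹ = proj₁ (proj₂ isField x x≉0)
    xx⁻¹≈1 : x * x⁻¹ ≈ 1#
    xx⁻¹≈1 = proj₂ (proj₂ isField x x≉0)

  x≉0∧xy≈0⇒y≈0 : ∀ {x y} → x ≉ 0# → x * y ≈ 0# → y ≈ 0#
  x≉0∧xy≈0⇒y≈0 {x} x≉0 xy≈0 = *-cancelˡ x≉0 (trans xy≈0 (sym (zeroʳ x)))

  x≉0∧y≉0⇒xy≉0 : ∀ {x y} → x ≉ 0# → y ≉ 0# → x * y ≉ 0#
  x≉0∧y≉0⇒xy≉0 x≉0 y≉0 = y≉0 ∘ x≉0∧xy≈0⇒y≈0 x≉0

  x≉0⇒xⁿ≉0 : ∀ {x} n → x ≉ 0# → pow x n ≉ 0#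
  x≉0⇒xⁿ≉0 zero    x≉0 = 1≉0
  x≉0⇒xⁿ≉0 (suc n) x≉0 = x≉0∧y≉0⇒xy≉0 x≉0 (x≉0⇒xⁿ≉0 n x≉0)

  x≉0∧xᵐ⁺ⁿ≈xᵐ⇒xⁿ≈1 : ∀ {x} m n → x ≉ 0# → pow x (m ℕ.+ n) ≈ pow x m → pow x n ≈ 1#
  x≉0∧xᵐ⁺ⁿ≈xᵐ⇒xⁿ≈1 {x} m n x≉0 xᵐ⁺ⁿ≈xᵐ = *-cancelˡ (x≉0⇒xⁿ≉0 m x≉0) (begin
    pow x m * pow x n  ≈⟨ pow-homo-+ x m n ⟨
    pow x (m ℕ.+ n)    ≈⟨ xᵐ⁺ⁿ≈xᵐ ⟩
    pow x m            ≈⟨ *-identityʳ (pow x m) ⟨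
    pow x m * 1#       ∎)

module PowerSums {c ℓ : Level} (R : CommutativeRing c ℓ) where
  open CommutativeRing R
  open FieldDefs R using (IsField; pow)
  open import Relation.Binary.Reasoning.Setoid setoid
  open import Algebra.Solver.Ring.NaturalCoefficients.Default commutativeSemiring
  open import Algebra.Properties.Ring ring using (x∙y⁻¹≈ε⇒x≈y)

  powerSum : ∀ {n} → Vec (Carrier × Carrier) n → ℕ → Carrier
  powerSum []             k = 0#
  powerSum ((b , d) ∷ ps) k = b * pow d k + powerSum ps k

  scaleByNode : Carrier → Carrier × Carrier → Carrier × Carrier
  scaleByNode t (b , d) = b * (d + t) , d

  powerSum-scaleByNode : ∀ t {n} (ps : Vec (Carrier × Carrier) n) k →
    powerSum (Vec.map (scaleByNode t) ps) k ≈ powerSum ps (suc k) + t * powerSum ps k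
  powerSum-scaleByNode t []             k = sym (trans (+-identityˡ _) (zeroʳ t))
  powerSum-scaleByNode t ((b , d) ∷ ps) k = begin
    b * (d + t) * pow d k + powerSum (Vec.map (scaleByNode t) ps) k
      ≈⟨ +-congˡ (powerSum-scaleByNode t ps k) ⟩
    b * (d + t) * pow d k + (powerSum ps (suc k) + t * powerSum ps k)
      ≈⟨ solve 6 (λ b d t x s₁ s₀ → b :* (d :+ t) :* x :+ (s₁ :+ t :* s₀)
                                    := (b :* (d :* x) :+ s₁) :+ t :* (b :* x :+ s₀))
               refl b d t (pow d k) (powerSum ps (suc k)) (powerSum ps k) ⟩
    (b * pow d (suc k) + powerSum ps (suc k)) + t * (b * pow d k + powerSum ps k)
      ∎

  module _ (isField : IsField) where
    open Field R isField

    -- Scaling every weight b by (d - e) turns the k-th power sum into the (k+1)-th minus e times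
    -- the k-th, and kills the node e.
    powerSums≈0⇒weight≈0 : ∀ {n} b d (ps : Vec (Carrier × Carrier) n) → All ((d ≉_) ∘ proj₂) ps →
      (∀ k → k ℕ.≤ n → powerSum ((b , d) ∷ ps) k ≈ 0#) → b ≈ 0#
    powerSums≈0⇒weight≈0 b d [] [] vanish = begin
      b            ≈⟨ *-identityʳ b ⟨
      b * 1#       ≈⟨ +-identityʳ _ ⟨
      b * 1# + 0#  ≈⟨ vanish 0 z≤n ⟩
      0#           ∎
    powerSums≈0⇒weight≈0 b d ((a , e) ∷ ps) (d≉e ∷ d≉ps) vanish =
      x≉0∧xy≈0⇒y≈0 d-e≉0
        (trans (*-comm _ _) (powerSums≈0⇒weight≈0 (b * (d - e)) d ps′ (All.map⁺ d≉ps) vanish′))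
      where
      ps′ : Vec (Carrier × Carrier) _
      ps′ = Vec.map (scaleByNode (- e)) ps
      d-e≉0 : d - e ≉ 0#
      d-e≉0 = d≉e ∘ x∙y⁻¹≈ε⇒x≈y d e
      eliminated : ∀ k → a * (e - e) * pow e k ≈ 0#
      eliminated k = trans (*-congʳ (trans (*-congˡ (-‿inverseʳ e)) (zeroʳ a))) (zeroˡ _)
      vanish′ : ∀ k → k ℕ.≤ _ → powerSum ((b * (d - e) , d) ∷ ps′) k ≈ 0#
      vanish′ k k≤n = begin
        b * (d - e) * pow d k + powerSum ps′ k
          ≈⟨ +-congˡ (trans (+-congʳ (eliminated k)) (+-identityˡ _)) ⟨
        powerSum (Vec.map (scaleByNode (- e)) ((b , d) ∷ (a , e) ∷ ps)) k
          ≈⟨ powerSum-scaleByNode (- e) ((b , d) ∷ (a , e) ∷ ps) k ⟩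
        powerSum ((b , d) ∷ (a , e) ∷ ps) (suc k) + - e * powerSum ((b , d) ∷ (a , e) ∷ ps) k
          ≈⟨ +-cong (vanish (suc k) (s≤s k≤n)) (*-congˡ (vanish k (ℕ.m≤n⇒m≤1+n k≤n))) ⟩
        0# + - e * 0#
          ≈⟨ trans (+-identityˡ _) (zeroʳ (- e)) ⟩
        0#
          ∎

module FiniteField {c ℓ : Level} (R : CommutativeRing c ℓ) (isField : FieldDefs.IsField R)
                   {N : ℕ} (card : FieldDefs.HasCard R (suc N)) where
  open CommutativeRing R
  open FieldDefs R using (pow; Primitive)
  open Powers R
  open Field R isField
  open import Relation.Binary.Reasoning.Setoid setoid

  private
    enum : Fin (suc N) → Carrier
    enum = proj₁ card

    enum-injective : ∀ i j → enum i ≈ enum j → i ≡ j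
    enum-injective = proj₁ (proj₂ card)

    enum-surjective : ∀ a → ∃ λ i → enum i ≈ a
    enum-surjective = proj₂ (proj₂ card)

    zeroIndex : Fin (suc N)
    zeroIndex = proj₁ (enum-surjective 0#)

  nonzeroEnum : Fin N → Carrier
  nonzeroEnum k = enum (punchIn zeroIndex k)

  nonzeroEnum-injective : ∀ {i j} → nonzeroEnum i ≈ nonzeroEnum j → i ≡ j
  nonzeroEnum-injective eq = punchIn-injective zeroIndex _ _ (enum-injective _ _ eq)

  nonzeroEnum≉0 : ∀ k → nonzeroEnum k ≉ 0#
  nonzeroEnum≉0 k eq =
    punchInᵢ≢i zeroIndex k (enum-injective _ _ (trans eq (sym (proj₂ (enum-surjective 0#)))))

  nonzeroEnum-surjective : ∀ {a} → a ≉ 0# → ∃ λ k → nonzeroEnum k ≈ a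
  nonzeroEnum-surjective {a} a≉0 = punchOut zeroIndex≢i , (begin
    enum (punchIn zeroIndex (punchOut zeroIndex≢i)) ≡⟨ ≡.cong enum (punchIn-punchOut zeroIndex≢i) ⟩
    enum i                                          ≈⟨ proj₂ (enum-surjective a) ⟩
    a                                               ∎)
    where
    i : Fin (suc N)
    i = proj₁ (enum-surjective a)
    zeroIndex≢i : zeroIndex ≢ i
    zeroIndex≢i z≡i = a≉0 (begin
      a               ≈⟨ proj₂ (enum-surjective a) ⟨
      enum i          ≡⟨ ≡.cong enum z≡i ⟨
      enum zeroIndex  ≈⟨ proj₂ (enum-surjective 0#) ⟩
      0#              ∎)

  instance
    N-nonZero : NonZero N
    N-nonZero = nonZeroIndex (proj₁ (nonzeroEnum-surjective 1≉0))

  nonzero-cover⇒≤ : ∀ {t} (g : Fin t → Carrier) → (∀ {a} → a ≉ 0# → ∃ λ j → g j ≈ a) → N ℕ.≤ t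
  nonzero-cover⇒≤ g cover = injective⇒≤ index-injective
    where
    index : Fin N → Fin _
    index k = proj₁ (cover (nonzeroEnum≉0 k))
    index-injective : ∀ {i j} → index i ≡ index j → i ≡ j
    index-injective {i} {j} eq = nonzeroEnum-injective (begin
      nonzeroEnum i  ≈⟨ proj₂ (cover (nonzeroEnum≉0 i)) ⟨
      g (index i)    ≡⟨ ≡.cong g eq ⟩
      g (index j)    ≈⟨ proj₂ (cover (nonzeroEnum≉0 j)) ⟩
      nonzeroEnum j  ∎)

  nonzero-pigeonhole : ∀ {M} (u : Fin M → Carrier) → (∀ j → u j ≉ 0#) → N ℕ.< M →
                       ∃₂ λ i j → i Fin.< j × u i ≈ u j
  nonzero-pigeonhole u u≉0 N<M =
    let i , j , i<j , eq = pigeonhole N<M index in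
    i , j , i<j , (begin
      u i                  ≈⟨ proj₂ (nonzeroEnum-surjective (u≉0 i)) ⟨
      nonzeroEnum (index i) ≡⟨ ≡.cong nonzeroEnum eq ⟩
      nonzeroEnum (index j) ≈⟨ proj₂ (nonzeroEnum-surjective (u≉0 j)) ⟩
      u j                  ∎)
    where
    index : Fin _ → Fin N
    index j = proj₁ (nonzeroEnum-surjective (u≉0 j))

  module _ {α : Carrier} (isPrimitive : Primitive α) where

    pow≈1⇒N≤ : ∀ t .{{_ : NonZero t}} → pow α t ≈ 1# → N ℕ.≤ t
    pow≈1⇒N≤ t αᵗ≈1 = nonzero-cover⇒≤ (pow α ∘ toℕ) cover
      where
      cover : ∀ {a} → a ≉ 0# → ∃ λ (j : Fin t) → pow α (toℕ j) ≈ a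
      cover {a} a≉0 = let e , αᵉ≈a = isPrimitive a a≉0 in
        fromℕ< (m%n<n e t) , (begin
          pow α (toℕ (fromℕ< (m%n<n e t)))  ≡⟨ ≡.cong (pow α) (toℕ-fromℕ< (m%n<n e t)) ⟩
          pow α (e ℕ.% t)                   ≈⟨ pow-mod α t αᵗ≈1 e ⟨
          pow α e                           ≈⟨ αᵉ≈a ⟩
          a                                 ∎)

    -- In F₂ the zero element satisfies Primitive, since 1 = 0⁰.
    Primitive⇒≉0 : 2 ℕ.≤ N → α ≉ 0#
    Primitive⇒≉0 2≤N α≈0 = ℕ.<⇒≱ 2≤N (nonzero-cover⇒≤ (λ (_ : Fin 1) → 1#) cover)
      where
      cover : ∀ {a} → a ≉ 0# → ∃ λ (_ : Fin 1) → 1# ≈ a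
      cover {a} a≉0 with isPrimitive a a≉0
      ... | zero  , 1≈a    = Fin.zero , 1≈a
      ... | suc e , αᵉ⁺¹≈a = contradiction (trans (sym αᵉ⁺¹≈a) (trans (*-congʳ α≈0) (zeroˡ _))) a≉0

    pow-N≈1 : α ≉ 0# → pow α N ≈ 1#
    pow-N≈1 α≉0 with nonzero-pigeonhole (pow α ∘ toℕ) (λ j → x≉0⇒xⁿ≉0 (toℕ j) α≉0) ℕ.≤-refl
    ... | i , j , i<j , αⁱ≈αʲ = ≡.subst (λ e → pow α e ≈ 1#) d≡N αᵈ≈1
      where
      d : ℕ
      d = toℕ j ℕ.∸ toℕ i
      αᵈ≈1 : pow α d ≈ 1#
      αᵈ≈1 = x≉0∧xᵐ⁺ⁿ≈xᵐ⇒xⁿ≈1 (toℕ i) d α≉0 (begin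
        pow α (toℕ i ℕ.+ d)  ≡⟨ ≡.cong (pow α) (ℕ.m+[n∸m]≡n (ℕ.<⇒≤ i<j)) ⟩
        pow α (toℕ j)        ≈⟨ αⁱ≈αʲ ⟨
        pow α (toℕ i)        ∎)
      instance
        d-nonZero : NonZero d
        d-nonZero = ℕ.>-nonZero (ℕ.m<n⇒0<n∸m i<j)
      d≡N : d ≡ N
      d≡N = ℕ.≤-antisym (ℕ.≤-trans (ℕ.m∸n≤m (toℕ j) (toℕ i)) (ℕ.s≤s⁻¹ (toℕ<n j)))
                        (pow≈1⇒N≤ d αᵈ≈1)

    pow≈1⇒N∣ : α ≉ 0# → ∀ t → pow α t ≈ 1# → N ∣ t
    pow≈1⇒N∣ α≉0 t αᵗ≈1 with t ℕ.% N ℕ.≟ 0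
    ... | yes r≡0 = m%n≡0⇒n∣m t N r≡0
    ... | no  r≢0 = contradiction (pow≈1⇒N≤ (t ℕ.% N) {{ℕ.≢-nonZero r≢0}} αʳ≈1) (ℕ.<⇒≱ (m%n<n t N))
      where
      αʳ≈1 : pow α (t ℕ.% N) ≈ 1#
      αʳ≈1 = trans (sym (pow-mod α N (pow-N≈1 α≉0) t)) αᵗ≈1

module Trace {c ℓ : Level} (R : CommutativeRing c ℓ) (q : ℕ) where
  open CommutativeRing R
  open FieldDefs R using (pow; Tr)
  open Powers R
  open PowerSums R using (powerSum)
  open import Relation.Binary.Reasoning.Setoid setoid

  Tr-cong : ∀ {a b} → a ≈ b → Tr q a ≈ Tr q b
  Tr-cong a≈b = +-cong a≈b (+-cong (pow-cong q a≈b) (+-cong (pow-cong (q ℕ.^ 2) a≈b) (pow-cong (q ℕ.^ 3) a≈b)))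

  xᵠ≈x⇒x^qⁱ≈x : ∀ {x} → pow x q ≈ x → ∀ i → pow x (q ℕ.^ i) ≈ x
  xᵠ≈x⇒x^qⁱ≈x xᵠ≈x zero    = *-identityʳ _
  xᵠ≈x⇒x^qⁱ≈x {x} xᵠ≈x (suc i) = begin
    pow x (q ℕ.* q ℕ.^ i)   ≈⟨ pow-assocʳ x q (q ℕ.^ i) ⟨
    pow (pow x q) (q ℕ.^ i) ≈⟨ pow-cong (q ℕ.^ i) xᵠ≈x ⟩
    pow x (q ℕ.^ i)         ≈⟨ xᵠ≈x⇒x^qⁱ≈x xᵠ≈x i ⟩
    x                       ∎

  xᵠ≈x⇒[xⁿ]ᵠ≈xⁿ : ∀ {x} → pow x q ≈ x → ∀ n → pow (pow x n) q ≈ pow x n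
  xᵠ≈x⇒[xⁿ]ᵠ≈xⁿ {x} xᵠ≈x n = trans (pow-comm x n q) (pow-cong n xᵠ≈x)

  xᵠ≈x⇒Tr[xy]≈xTr[y] : ∀ {x} → pow x q ≈ x → ∀ y → Tr q (x * y) ≈ x * Tr q y
  xᵠ≈x⇒Tr[xy]≈xTr[y] {x} xᵠ≈x y = begin
    Tr q (x * y)
      ≈⟨ +-congˡ (+-cong (pull q xᵠ≈x)
                 (+-cong (pull (q ℕ.^ 2) (xᵠ≈x⇒x^qⁱ≈x xᵠ≈x 2)) (pull (q ℕ.^ 3) (xᵠ≈x⇒x^qⁱ≈x xᵠ≈x 3)))) ⟩
    x * y + (x * pow y q + (x * pow y (q ℕ.^ 2) + x * pow y (q ℕ.^ 3)))
      ≈⟨ +-congˡ (+-congˡ (distribˡ x _ _)) ⟨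
    x * y + (x * pow y q + x * (pow y (q ℕ.^ 2) + pow y (q ℕ.^ 3)))
      ≈⟨ +-congˡ (distribˡ x _ _) ⟨
    x * y + x * (pow y q + (pow y (q ℕ.^ 2) + pow y (q ℕ.^ 3)))
      ≈⟨ distribˡ x _ _ ⟨
    x * Tr q y
      ∎
    where
    pull : ∀ e → pow x e ≈ x → pow (x * y) e ≈ x * pow y e
    pull e xᵉ≈x = trans (pow-distrib-* x y e) (*-congʳ xᵉ≈x)

  conjugatePairs : Carrier → Carrier → Vec (Carrier × Carrier) 3
  conjugatePairs b d = (pow b q , pow d q)
                     ∷ (pow b (q ℕ.^ 2) , pow d (q ℕ.^ 2))
                     ∷ (pow b (q ℕ.^ 3) , pow d (q ℕ.^ 3))
                     ∷ []

  Tr-as-powerSum : ∀ b d k → Tr q (b * pow d k) ≈ powerSum ((b , d) ∷ conjugatePairs b d) k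
  Tr-as-powerSum b d k =
    +-congˡ (+-cong (conjugate q) (+-cong (conjugate (q ℕ.^ 2)) (trans (conjugate (q ℕ.^ 3)) (sym (+-identityʳ _)))))
    where
    conjugate : ∀ e → pow (b * pow d k) e ≈ pow b e * pow (pow d e) k
    conjugate e = trans (pow-distrib-* b (pow d k) e) (*-congˡ (pow-comm d k e))

module NatLemmas where
  open import Data.Nat.Base
  open import Data.Nat.Properties
  open import Data.Nat.Divisibility using (_∣_; divides)
  open import Data.Nat.Solver using (module +-*-Solver)
  open +-*-Solver
  open ≡ using (refl)

  ∣2i⇒2i≡ : ∀ {S i} → i ≢ 0 → i < S → S ∣ 2 * i → 2 * i ≡ S
  ∣2i⇒2i≡ i≢0 i<S (divides zero 2i≡0) = contradiction (*-cancelˡ-≡ _ 0 2 2i≡0) i≢0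
  ∣2i⇒2i≡ i≢0 i<S (divides 1 2i≡S) = ≡.trans 2i≡S (+-identityʳ _)
  ∣2i⇒2i≡ {S} i≢0 i<S (divides (suc (suc k)) 2i≡[2+k]S) =
    contradiction (≡.subst (2 * S ≤_) (≡.sym 2i≡[2+k]S) (*-monoˡ-≤ S {2} {2 + k} (s≤s (s≤s z≤n))))
                  (<⇒≱ (*-monoʳ-< 2 i<S))

  x+a[c+bl]≡x+ac+bal : ∀ x a c b l → x + a * (c + b * l) ≡ x + a * c + b * a * l
  x+a[c+bl]≡x+ac+bal = solve 5 (λ x a c b l → x :+ a :* (c :+ b :* l) := x :+ a :* c :+ b :* a :* l) refl

  x+au+aik≡x+a[u+ik] : ∀ x a u i k → x + a * u + a * i * k ≡ x + a * (u + i * k)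
  x+au+aik≡x+a[u+ik] = solve 5 (λ x a u i k → x :+ a :* u :+ a :* i :* k := x :+ a :* (u :+ i :* k)) refl

-- q = p + 1, so that N = n (q - 1) = q⁴ - 1 is the order of the multiplicative group.
module Exponents (p : ℕ) where
  open import Data.Nat.Base
  open import Data.Nat.Properties
  open import Data.Nat.Divisibility using (_∣_; ∣m+n∣m⇒∣n; n∣m*n; ∣m⇒∣m*n; ∣n⇒∣m*n; *-cancelˡ-∣)
  open import Data.Nat.Solver using (module +-*-Solver)
  open +-*-Solver
  open ≡ using (refl; cong; cong₂; subst)
  open ≡.≡-Reasoning

  q S n N : ℕ
  q = suc p
  S = q ^ 2 + 1
  n = S * (q + 1)
  N = n * p

  q⁴≡1+N : q ^ 4 ≡ suc N
  q⁴≡1+N = solve 1 (λ p → (con 1 :+ p) :^ 4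
                         := con 1 :+ ((con 1 :+ p) :^ 2 :+ con 1) :* ((con 1 :+ p) :+ con 1) :* p) refl p

  q≡1+p*1 : q ≡ suc (p * 1)
  q≡1+p*1 = cong suc (≡.sym (*-identityʳ p))

  q²≡1+p*[q+1] : q ^ 2 ≡ suc (p * (q + 1))
  q²≡1+p*[q+1] = solve 1 (λ p → (con 1 :+ p) :^ 2 := con 1 :+ p :* ((con 1 :+ p) :+ con 1)) refl p

  q³≡1+p*[q²+q+1] : q ^ 3 ≡ suc (p * (q ^ 2 + q + 1))
  q³≡1+p*[q²+q+1] = solve 1 (λ p → (con 1 :+ p) :^ 3
                                 := con 1 :+ p :* ((con 1 :+ p) :^ 2 :+ (con 1 :+ p) :+ con 1)) refl p

  n*q≡n+N : n * q ≡ n + N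
  n*q≡n+N = *-suc n p

  S≡1+q² : S ≡ suc (q ^ 2)
  S≡1+q² = +-comm (q ^ 2) 1

  module _ .{{_ : NonZero p}} where

    2≤N : 2 ≤ N
    2≤N = *-mono-≤ (*-mono-≤ (+-monoˡ-≤ 1 (m^n>0 q 2)) (m≤n+m 1 q)) (>-nonZero⁻¹ p)

    N∣[q+1]i*[p*c]⇒S∣i*c : ∀ {i c} → N ∣ (q + 1) * i * (p * c) → S ∣ i * c
    N∣[q+1]i*[p*c]⇒S∣i*c {i} {c} = *-cancelˡ-∣ ((q + 1) * p) {{m*n≢0 (q + 1) p}} ∘ regroup
      where
      regroup : N ∣ (q + 1) * i * (p * c) → (q + 1) * p * S ∣ (q + 1) * p * (i * c)
      regroup = ≡.subst₂ _∣_
        (solve 2 (λ p S → S :* ((con 1 :+ p) :+ con 1) :* p := ((con 1 :+ p) :+ con 1) :* p :* S) refl p S)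
        (solve 3 (λ p i c → ((con 1 :+ p) :+ con 1) :* i :* (p :* c)
                          := ((con 1 :+ p) :+ con 1) :* p :* (i :* c)) refl p i c)

  S∣i*1⇒S∣2i : ∀ {i} → S ∣ i * 1 → S ∣ 2 * i
  S∣i*1⇒S∣2i {i} S∣i = ∣n⇒∣m*n 2 (subst (S ∣_) (*-identityʳ i) S∣i)

  S∣i*[q+1]⇒S∣2i : ∀ {i} → S ∣ i * (q + 1) → S ∣ 2 * i
  S∣i*[q+1]⇒S∣2i {i} S∣i[q+1] = ∣m+n∣m⇒∣n S∣i[q+1]p+2i (∣m⇒∣m*n p S∣i[q+1])
    where
    S∣i[q+1]p+2i : S ∣ i * (q + 1) * p + 2 * i
    S∣i[q+1]p+2i = subst (S ∣_)
      (solve 2 (λ i p → i :* ((con 1 :+ p) :^ 2 :+ con 1) := i :* ((con 1 :+ p) :+ con 1) :* p :+ con 2 :* i) refl i p)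
      (n∣m*n i)

  S∣i*[q²+q+1]⇒S∣2i : ∀ {i} → S ∣ i * (q ^ 2 + q + 1) → S ∣ 2 * i
  S∣i*[q²+q+1]⇒S∣2i {i} S∣i[q²+q+1] = ∣n⇒∣m*n 2 (∣m+n∣m⇒∣n S∣iqq+i (∣m⇒∣m*n q S∣iq))
    where
    S∣iq : S ∣ i * q
    S∣iq = ∣m+n∣m⇒∣n (subst (S ∣_) i[q²+q+1]≡iS+iq S∣i[q²+q+1]) (n∣m*n i)
      where
      i[q²+q+1]≡iS+iq : i * (q ^ 2 + q + 1) ≡ i * S + i * q
      i[q²+q+1]≡iS+iq = solve 2 (λ i q → i :* (q :^ 2 :+ q :+ con 1) := i :* (q :^ 2 :+ con 1) :+ i :* q) refl i q
    S∣iqq+i : S ∣ i * q * q + i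
    S∣iqq+i = subst (S ∣_) (solve 2 (λ i q → i :* (q :^ 2 :+ con 1) := i :* q :* q :+ i) refl i q) (n∣m*n i)

  module _ (u i : ℕ) (u+i≡S : u + i ≡ S) where

    progression₀ : u + i * 0 ≡ u + S * 0
    progression₀ = cong (u +_) (≡.trans (*-zeroʳ i) (≡.sym (*-zeroʳ S)))

    progression₁ : u + i * 1 ≡ 0 + S * 1
    progression₁ = begin
      u + i * 1  ≡⟨ cong (u +_) (*-identityʳ i) ⟩
      u + i      ≡⟨ u+i≡S ⟩
      S          ≡⟨ *-identityʳ S ⟨
      0 + S * 1  ∎

    progression₂ : u + i * 2 ≡ i + S * 1
    progression₂ = begin
      u + i * 2        ≡⟨ solve 2 (λ u i → u :+ i :* con 2 := i :+ (u :+ i) :* con 1) refl u i ⟩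
      i + (u + i) * 1  ≡⟨ cong (λ s → i + s * 1) u+i≡S ⟩
      i + S * 1        ∎

    progression₃ : ∀ r s → 2 * i ≡ r + s * suc (q ^ 2) → u + i * 3 ≡ r + S * suc s
    progression₃ r s 2i≡r+sS = begin
      u + i * 3          ≡⟨ solve 2 (λ u i → u :+ i :* con 3 := (u :+ i) :+ con 2 :* i) refl u i ⟩
      (u + i) + 2 * i    ≡⟨ cong₂ _+_ u+i≡S (≡.trans 2i≡r+sS (cong (λ S′ → r + s * S′) (≡.sym S≡1+q²))) ⟩
      S + (r + s * S)    ≡⟨ solve 3 (λ S r s → S :+ (r :+ s :* S) := r :+ S :* (con 1 :+ s)) refl S r s ⟩
      r + S * suc s      ∎

module _ {c ℓ : Level} (F : CommutativeRing c ℓ) (isField : FieldDefs.IsField F)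
         (p : ℕ) .{{_ : NonZero p}} (card : FieldDefs.HasCard F (suc p ℕ.^ 4))
         {α : CommutativeRing.Carrier F} (isPrimitive : FieldDefs.Primitive F α) where
  open CommutativeRing F
  open FieldDefs F
  open Powers F
  open Field F isField
  open PowerSums F
  open NatLemmas
  open Exponents p
  open Trace F q
  open FiniteField F isField (≡.subst HasCard q⁴≡1+N card)
  open import Relation.Binary.Reasoning.Setoid setoid

  α≉0 : α ≉ 0#
  α≉0 = Primitive⇒≉0 isPrimitive 2≤N

  [αⁿ]ᵠ≈αⁿ : pow (pow α n) q ≈ pow α n
  [αⁿ]ᵠ≈αⁿ = begin
    pow (pow α n) q    ≈⟨ pow-assocʳ α n q ⟩
    pow α (n ℕ.* q)    ≡⟨ ≡.cong (pow α) n*q≡n+N ⟩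
    pow α (n ℕ.+ N)    ≈⟨ pow-homo-+ α n N ⟩
    pow α n * pow α N  ≈⟨ *-congˡ (pow-N≈1 isPrimitive α≉0) ⟩
    pow α n * 1#       ≈⟨ *-identityʳ _ ⟩
    pow α n            ∎

  InD-+-multiple : ∀ {j} → InD q α j → ∀ l → InD q α (j ℕ.+ n ℕ.* l)
  InD-+-multiple {j} j∈D l = begin
    Tr q (pow α (j ℕ.+ n ℕ.* l))      ≈⟨ Tr-cong αʲ⁺ⁿˡ≈αⁿˡαʲ ⟩
    Tr q (pow (pow α n) l * pow α j)  ≈⟨ xᵠ≈x⇒Tr[xy]≈xTr[y] (xᵠ≈x⇒[xⁿ]ᵠ≈xⁿ [αⁿ]ᵠ≈αⁿ l) (pow α j) ⟩
    pow (pow α n) l * Tr q (pow α j)  ≈⟨ *-congˡ j∈D ⟩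
    pow (pow α n) l * 0#              ≈⟨ zeroʳ _ ⟩
    0#                                ∎
    where
    αʲ⁺ⁿˡ≈αⁿˡαʲ : pow α (j ℕ.+ n ℕ.* l) ≈ pow (pow α n) l * pow α j
    αʲ⁺ⁿˡ≈αⁿˡαʲ = trans (pow-homo-+ α j (n ℕ.* l)) (trans (*-comm _ _) (*-congʳ (sym (pow-assocʳ α n l))))

  InC-+-multiple : ∀ x c → InC q α x c → ∀ l → InC q α x (c ℕ.+ S ℕ.* l)
  InC-+-multiple x c c∈C l = ≡.subst (InD q α) (≡.sym (x+a[c+bl]≡x+ac+bal x (q ℕ.+ 1) c S l))
                                      (InD-+-multiple {x ℕ.+ (q ℕ.+ 1) ℕ.* c} c∈C l)

  no-four-term-progression : ∀ x u {i} → S ∤ 2 ℕ.* i → ¬ (∀ k → k ℕ.≤ 3 → InC q α x (u ℕ.+ i ℕ.* k))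
  no-four-term-progression x u {i} S∤2i progression =
    x≉0⇒xⁿ≉0 E α≉0 (powerSums≈0⇒weight≈0 isField β δ (conjugatePairs β δ) δ≉conjugates vanish)
    where
    E m : ℕ
    E = x ℕ.+ (q ℕ.+ 1) ℕ.* u
    m = (q ℕ.+ 1) ℕ.* i
    β δ : Carrier
    β = pow α E
    δ = pow α m

    δ≉δᵉ : ∀ {e c} → e ≡ suc (p ℕ.* c) → S ∤ i ℕ.* c → δ ≉ pow δ e
    δ≉δᵉ {e} {c} e≡1+pc S∤ic δ≈δᵉ =
      S∤ic (N∣[q+1]i*[p*c]⇒S∣i*c {i} {c} (pow≈1⇒N∣ isPrimitive α≉0 _ αᵐᵖᶜ≈1))
      where
      αᵐᵖᶜ≈1 : pow α (m ℕ.* (p ℕ.* c)) ≈ 1#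
      αᵐᵖᶜ≈1 = x≉0∧xᵐ⁺ⁿ≈xᵐ⇒xⁿ≈1 m _ α≉0 (begin
        pow α (m ℕ.+ m ℕ.* (p ℕ.* c))  ≡⟨ ≡.cong (pow α) (ℕ.*-suc m _) ⟨
        pow α (m ℕ.* suc (p ℕ.* c))    ≡⟨ ≡.cong (pow α ∘ (m ℕ.*_)) e≡1+pc ⟨
        pow α (m ℕ.* e)                ≈⟨ pow-assocʳ α m e ⟨
        pow δ e                        ≈⟨ δ≈δᵉ ⟨
        δ                              ∎)

    δ≉conjugates : All ((δ ≉_) ∘ proj₂) (conjugatePairs β δ)
    δ≉conjugates = δ≉δᵉ q≡1+p*1 (S∤2i ∘ S∣i*1⇒S∣2i {i})
                 ∷ δ≉δᵉ q²≡1+p*[q+1] (S∤2i ∘ S∣i*[q+1]⇒S∣2i {i})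
                 ∷ δ≉δᵉ q³≡1+p*[q²+q+1] (S∤2i ∘ S∣i*[q²+q+1]⇒S∣2i {i})
                 ∷ []

    vanish : ∀ k → k ℕ.≤ 3 → powerSum ((β , δ) ∷ conjugatePairs β δ) k ≈ 0#
    vanish k k≤3 = begin
      powerSum ((β , δ) ∷ conjugatePairs β δ) k       ≈⟨ Tr-as-powerSum β δ k ⟨
      Tr q (β * pow δ k)                              ≈⟨ Tr-cong βδᵏ-as-power ⟩
      Tr q (pow α (x ℕ.+ (q ℕ.+ 1) ℕ.* (u ℕ.+ i ℕ.* k))) ≈⟨ progression k k≤3 ⟩
      0#                                              ∎
      where
      βδᵏ-as-power : β * pow δ k ≈ pow α (x ℕ.+ (q ℕ.+ 1) ℕ.* (u ℕ.+ i ℕ.* k))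
      βδᵏ-as-power = begin
        β * pow δ k            ≈⟨ *-congˡ (pow-assocʳ α m k) ⟩
        β * pow α (m ℕ.* k)    ≈⟨ pow-homo-+ α E (m ℕ.* k) ⟨
        pow α (E ℕ.+ m ℕ.* k)  ≡⟨ ≡.cong (pow α) (x+au+aik≡x+a[u+ik] x (q ℕ.+ 1) u i k) ⟩
        pow α (x ℕ.+ (q ℕ.+ 1) ℕ.* (u ℕ.+ i ℕ.* k)) ∎

open import Data.Nat.Base using (_+_; _*_; _∸_; _^_; _<_; _%_)
open import Data.Nat.Primality using (prime)

oddPrimePower⇒2≤ : ∀ {q} → OddPrimePower q → 2 ℕ.≤ q
oddPrimePower⇒2≤ (p , zero  , _ , _ , () , _)
oddPrimePower⇒2≤ (p , suc k , prime _ , _ , _ , ≡.refl) =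
  ℕ.*-mono-≤ (ℕ.nonTrivial⇒n>1 p) (ℕ.m^n>0 p {{ℕ.nonTrivial⇒nonZero p}} k)

mainTheorem15 : {c ℓ : Level} (q : ℕ) → OddPrimePower q →
    (F : CommutativeRing c ℓ) → FieldDefs.IsField F → FieldDefs.HasCard F (q ^ 4) →
    (α : CommutativeRing.Carrier F) → FieldDefs.Primitive F α →
    (x : ℕ) → x < (q ^ 2 + 1) * (q + 1) → FieldDefs.InD F q α x →
    (i : ℕ) → i < q ^ 2 + 1 → ¬ (i ≡ 0) → ¬ (2 * i ≡ q ^ 2 + 1) →
    FieldDefs.InC F q α x 0 →
    FieldDefs.InC F q α x i →
    FieldDefs.InC F q α x ((q ^ 2 + 1) ∸ i) →
    ¬ FieldDefs.InC F q α x ((2 * i) % suc (q ^ 2))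
mainTheorem15 q opp F isField card α isPrimitive x _ _ i i<S i≢0 2i≢S 0∈C i∈C -i∈C 2i∈C
  with s≤s (s≤s {n = p′} z≤n) ← oddPrimePower⇒2≤ opp =
  no-four-term-progression F isField (suc p′) card isPrimitive x u {i} S∤2i progression
  where
  open Exponents (suc p′) hiding (q)
  open FieldDefs F using (InC)
  open ≡ using (subst; sym)
  u : ℕ
  u = S ∸ i
  u+i≡S : u + i ≡ S
  u+i≡S = ℕ.m∸n+n≡m (ℕ.<⇒≤ i<S)
  S∤2i : S ∤ 2 * i
  S∤2i S∣2i = 2i≢S (NatLemmas.∣2i⇒2i≡ i≢0 i<S S∣2i)
  shift : ∀ c → InC q α x c → ∀ l → InC q α x (c + S * l)
  shift = InC-+-multiple F isField (suc p′) card isPrimitive x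
  progression : ∀ k → k ℕ.≤ 3 → InC q α x (u + i * k)
  progression 0 _ = subst (InC q α x) (sym (progression₀ u i u+i≡S)) (shift u -i∈C 0)
  progression 1 _ = subst (InC q α x) (sym (progression₁ u i u+i≡S)) (shift 0 0∈C 1)
  progression 2 _ = subst (InC q α x) (sym (progression₂ u i u+i≡S)) (shift i i∈C 1)
  progression 3 _ = subst (InC q α x) (sym (progression₃ u i u+i≡S r s 2i≡r+sS)) (shift r 2i∈C (suc s))
    where
    r s : ℕ
    r = (2 * i) % suc (q ^ 2)
    s = (2 * i) ℕ./ suc (q ^ 2)
    2i≡r+sS : 2 * i ≡ r + s * suc (q ^ 2)
    2i≡r+sS = m≡m%n+[m/n]*n (2 * i) (suc (q ^ 2))
  progression (suc (suc (suc (suc _)))) (s≤s (s≤s (s≤s ())))
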